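{- Let $G$ be a graph without isolated vertices and let $T$ be a solution counting decision tree for $\varphi(G)$. Let $u$ be a node of $T$ labelled by the variable $x\in V(G)$, and assume that $x$ is not forced to $1$ by $A_u$. Then $|F^u|_{\neg x}|/|F^u|\ge (1/2)^{|N^u(x)|+1}$ and $|F^u|_x|/|F^u|\ge 1/2$.
   Context: $\varphi(G)$ is the CNF with variables $V(G)$ and clauses $(a\vee b)$ for $\{a,b\}\in E(G)$. Boolean functions are identified with their sets of satisfying assignments (sets of literals); $|\cdot|$ counts them. For a set of literals $S$, the restriction $F|_S$ is the function on $Var(F)\setminus Var(S)$ whose satisfying assignments are those $S'$ with $S\cup S'$ satisfying $F$. A decision tree for $F$ (not constant zero): label the root with some $x\in Var(F)$; for each literal $\ell$ of $x$ occurring in some satisfying assignment of $F$, add an outgoing edge labelled $\ell$ whose head is a leaf if $|Var(F)|=1$ and otherwise roots a decision tree for $F|_\ell$. A solution counting decision tree (SCDT) additionally gives the edge labelled $\ell$ leaving node $u$ the weight $|F|_{A_u\cup\{\ell\}}|/|F|_{A_u}|$. For a node $u$ of $T$, $A_u$ is the set of literals labelling the root-$u$ path, and $F^u=\varphi(G)|_{A_u}$. A vertex $y$ of $G$ is forced to $1$ by $A_u$ if some neighbour of $y$ occurs negatively in $A_u$. $N^u(x)$ is the set of neighbours $y$ of $x$ that are neither assigned by $A_u$ (i.e. $y\notin Var(A_u)$) nor forced to $1$ by $A_u$. -}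

module Defs where

open import Data.Nat using (ℕ; zero; suc; _+_; _*_; _^_; _≤_; _<_)
open import Data.Bool using (Bool; true; false; _∧_; _∨_; not; if_then_else_)
open import Data.Maybe using (Maybe; just; nothing)
open import Data.Fin using (Fin; _≟_)
open import Data.Vec using (Vec; []; _∷_; lookup)
open import Data.List using (List; []; _∷_; _++_; map; allFin)
open import Data.Bool.ListAction using (all; any)
open import Data.Product using (Σ; ∃; _×_)
open import Relation.Nullary using (¬_)
open import Relation.Nullary.Decidable using (⌊_⌋)
open import Relation.Binary.PropositionalEquality using (_≡_)

record Graph (n : ℕ) : Set where
  field
    E      : Fin n → Fin n → Bool
    sym    : ∀ a b → E a b ≡ E b a
    irrefl : ∀ a → E a a ≡ false
open Graph public

NoIsolated : ∀ {n} → Graph n → Set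
NoIsolated {n} G = ∀ (v : Fin n) → ∃ λ w → E G v w ≡ true

countB : ∀ {A : Set} → (A → Bool) → List A → ℕ
countB p []       = 0
countB p (a ∷ as) = if p a then suc (countB p as) else countB p as

allVecs : (n : ℕ) → List (Vec Bool n)
allVecs zero    = [] ∷ []
allVecs (suc n) = map (true ∷_) (allVecs n) ++ map (false ∷_) (allVecs n)

-- Sets of literals = partial assignments: A v = just b means the literal
-- v (b = true) or ¬v (b = false) is in the set; nothing = v ∉ Var(A).

PAssign : ℕ → Set
PAssign n = Fin n → Maybe Bool

∅ : ∀ {n} → PAssign n
∅ _ = nothing

_[_≔_] : ∀ {n} → PAssign n → Fin n → Bool → PAssign n
(A [ x ≔ b ]) y = if ⌊ y ≟ x ⌋ then just b else A y

satφ : ∀ {n} → Graph n → Vec Bool n → Bool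
satφ {n} G σ =
  all (λ a → all (λ b → not (E G a b) ∨ (lookup σ a ∨ lookup σ b)) (allFin n)) (allFin n)

agreeLit : Maybe Bool → Bool → Bool
agreeLit nothing      _     = true
agreeLit (just true)  c     = c
agreeLit (just false) c     = not c

extends : ∀ {n} → PAssign n → Vec Bool n → Bool
extends {n} A σ = all (λ a → agreeLit (A a) (lookup σ a)) (allFin n)

-- |φ(G)|_A| : satisfying assignments S' of φ(G)|_A are in bijection with
-- the total satisfying assignments of φ(G) extending A.
#φ : ∀ {n} → Graph n → PAssign n → ℕ
#φ {n} G A = countB (λ σ → satφ G σ ∧ extends A σ) (allVecs n)

-- Decision trees for φ(G)|_A (indexed by the literal set A labelling the
-- path from the root).

Total : ∀ {n} → PAssign n → Set
Total {n} A = ∀ (y : Fin n) → ¬ (A y ≡ nothing)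

mutual
  data DT {n : ℕ} (G : Graph n) (A : PAssign n) : Set where
    node : (x : Fin n) → A x ≡ nothing →
           ((b : Bool) → 0 < #φ G (A [ x ≔ b ]) → Child G (A [ x ≔ b ])) →
           DT G A

  data Child {n : ℕ} (G : Graph n) (A : PAssign n) : Set where
    leaf : Total A → Child G A
    sub  : (∃ λ y → A y ≡ nothing) → DT G A → Child G A

-- Edge weights of a solution counting decision tree are determined by
-- the tree: the edge labelled ℓ leaving a node u gets |F|_{A_u ∪ {ℓ}}| / |F|_{A_u}|.
-- Numerator / denominator of that weight:
weight : ∀ {n} → Graph n → PAssign n → Fin n → Bool → ℕ × ℕ
weight G A x b = Data.Product._,_ (#φ G (A [ x ≔ b ])) (#φ G A)

-- An SCDT for φ(G): a decision tree for φ(G) (whose root function is the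
-- unrestricted φ(G)), equipped with the weights above.
SCDT : ∀ {n} → Graph n → Set
SCDT G = DT G ∅

mutual
  data NodeAt {n : ℕ} {G : Graph n} : {A : PAssign n} → DT G A → PAssign n → Fin n → Set where
    here  : ∀ {A x p ch} → NodeAt {A = A} (node x p ch) A x
    there : ∀ {A x p ch B y} (b : Bool) (pos : 0 < #φ G (A [ x ≔ b ])) →
            NodeAtC (ch b pos) B y → NodeAt {A = A} (node x p ch) B y

  data NodeAtC {n : ℕ} {G : Graph n} : {A : PAssign n} → Child G A → PAssign n → Fin n → Set where
    inSub : ∀ {A q t B y} → NodeAt {A = A} t B y → NodeAtC {A = A} (sub q t) B y

Forced : ∀ {n} → Graph n → PAssign n → Fin n → Set
Forced G A y = ∃ λ z → (E G y z ≡ true) × (A z ≡ just false)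

isFalse : Maybe Bool → Bool
isFalse (just false) = true
isFalse _            = false

isNothing : Maybe Bool → Bool
isNothing nothing = true
isNothing _       = false

forcedB : ∀ {n} → Graph n → PAssign n → Fin n → Bool
forcedB {n} G A y = any (λ z → E G y z ∧ isFalse (A z)) (allFin n)

#N : ∀ {n} → Graph n → PAssign n → Fin n → ℕ
#N {n} G A x = countB (λ y → E G x y ∧ (isNothing (A y) ∧ not (forcedB G A y))) (allFin n)

module Submission where

-- Both estimates are "compression" arguments on the models of φ(G)|_B.
-- To a model σ of φ(G) extending B we apply the map that overrides σ by a
-- partial assignment D; a map that overrides k variables is at most
-- 2^k-to-one, so |models of B| ≤ 2^k · |models of the image|
-- (override-bound).  We use D = {x ↦ c} ∪ {y ↦ 1 : q y}, which lands in the
-- models of B ∪ {x ↦ c} as soon as it preserves φ(G) (restriction-bound).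
--   * c = 1, q empty: raising x keeps every clause true, so |F^u| ≤ 2|F^u|_x|.
--   * c = 0, q = N^u(x): lowering x is repaired by raising the free
--     neighbours of x; all other neighbours are already 1 in every model,
--     since they are either assigned 1 by B or forced to 1 by B (and none is
--     assigned 0, as x is not forced).  Hence |F^u| ≤ 2^{|N^u(x)|+1}|F^u|_¬x|.

open import Defs
open import Data.Nat using (ℕ; suc; _*_; _^_; _≤_)
open import Data.Bool using (true; false)
open import Data.Product using (_×_)
open import Relation.Nullary using (¬_)

open import Data.Nat using (zero; _+_; s≤s)
open import Data.Nat.Properties
  using (≤-refl; ≤-trans; ≤-reflexive; m≤m+n; m≤n+m; +-mono-≤; *-monoʳ-≤;
         *-distribˡ-+; *-assoc; *-identityˡ; +-identityʳ; module ≤-Reasoning)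
open import Data.Bool using (Bool; _∧_; _∨_; not; if_then_else_; T)
open import Data.Bool.Properties using (T-≡; ∨-comm; ∨-identityʳ; ∨-zeroʳ)
open import Data.Bool.ListAction using (all)
open import Data.Maybe using (Maybe; just; nothing; fromMaybe; is-just)
open import Data.Fin as Fin using (Fin; _≟_)
open import Data.Fin.Properties using (suc-injective)
open import Data.Vec using (Vec; []; _∷_; lookup)
open import Data.List using (List; []; _∷_; _++_; map; allFin; tabulate)
open import Data.List.Properties using (map-tabulate)
open import Data.List.Relation.Unary.All.Properties using (all⁺; all⁻; tabulate⁺; tabulate⁻)
open import Data.List.Relation.Unary.Any using (satisfied)
open import Data.List.Relation.Unary.Any.Properties using (any⁻)
open import Data.Product using (_,_; proj₁; proj₂)
open import Data.Sum using (_⊎_; inj₁; inj₂) renaming (map to ⊎-map)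
open import Data.Empty using (⊥-elim)
open import Function using (_∘_; id)
open import Function.Bundles using (module Equivalence)
open import Relation.Nullary using (yes; no)
open import Relation.Binary.PropositionalEquality
  using (_≡_; _≢_; refl; trans; cong; cong₂; subst)
  renaming (sym to ≡-sym)

private
  variable
    n : ℕ

T⇒≡ : ∀ {b} → T b → b ≡ true
T⇒≡ = Equivalence.to T-≡

≡⇒T : ∀ {b} → b ≡ true → T b
≡⇒T = Equivalence.from T-≡

∧-elim : ∀ a b → a ∧ b ≡ true → a ≡ true × b ≡ true
∧-elim true b b≡true = refl , b≡true

∧-intro : ∀ a b → a ≡ true → b ≡ true → a ∧ b ≡ true
∧-intro .true b refl b≡true = b≡true

∨-elim : ∀ a b → a ∨ b ≡ true → a ≡ true ⊎ b ≡ true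
∨-elim true  b _      = inj₁ refl
∨-elim false b b≡true = inj₂ b≡true

∨-intro : ∀ a b → a ≡ true ⊎ b ≡ true → a ∨ b ≡ true
∨-intro .true b (inj₁ refl) = refl
∨-intro a .true (inj₂ refl) = ∨-zeroʳ a

∨-resolveʳ : ∀ a b → a ∨ b ≡ true → b ≡ false → a ≡ true
∨-resolveʳ a .false a∨b refl = trans (≡-sym (∨-identityʳ a)) a∨b

all-allFin-elim : ∀ (p : Fin n → Bool) → all p (allFin n) ≡ true → ∀ a → p a ≡ true
all-allFin-elim {n} p h a = T⇒≡ (tabulate⁻ (all⁺ p (allFin n) (≡⇒T h)) a)

all-allFin-intro : ∀ (p : Fin n → Bool) → (∀ a → p a ≡ true) → all p (allFin n) ≡ true
all-allFin-intro p h = T⇒≡ (all⁻ p (tabulate⁺ (≡⇒T ∘ h)))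

countB-ext : ∀ {A : Set} (p q : A → Bool) → (∀ a → p a ≡ q a) →
             ∀ xs → countB p xs ≡ countB q xs
countB-ext p q p≡q []       = refl
countB-ext p q p≡q (a ∷ xs) rewrite p≡q a | countB-ext p q p≡q xs = refl

countB-mono : ∀ {A : Set} (p q : A → Bool) → (∀ a → p a ≡ true → q a ≡ true) →
              ∀ xs → countB p xs ≤ countB q xs
countB-mono p q p⇒q []       = ≤-refl
countB-mono p q p⇒q (a ∷ xs) with p a in pa | q a in qa
... | true  | true  = s≤s (countB-mono p q p⇒q xs)
... | true  | false with trans (≡-sym (p⇒q a pa)) qa
...   | ()
countB-mono p q p⇒q (a ∷ xs) | false | true  =
  ≤-trans (countB-mono p q p⇒q xs) (m≤n+m _ 1)
countB-mono p q p⇒q (a ∷ xs) | false | false = countB-mono p q p⇒q xs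

countB-false : ∀ {A : Set} (xs : List A) → countB (λ _ → false) xs ≡ 0
countB-false []       = refl
countB-false (_ ∷ xs) = countB-false xs

countB-++ : ∀ {A : Set} (p : A → Bool) xs ys →
            countB p (xs ++ ys) ≡ countB p xs + countB p ys
countB-++ p []       ys = refl
countB-++ p (a ∷ xs) ys with p a
... | true  = cong suc (countB-++ p xs ys)
... | false = countB-++ p xs ys

countB-map : ∀ {A B : Set} (p : B → Bool) (f : A → B) xs →
             countB p (map f xs) ≡ countB (p ∘ f) xs
countB-map p f []       = refl
countB-map p f (a ∷ xs) with p (f a)
... | true  = cong suc (countB-map p f xs)
... | false = countB-map p f xs

countB-tabulate-suc : ∀ (q : Fin (suc n) → Bool) →
  countB q (tabulate Fin.suc) ≡ countB (q ∘ Fin.suc) (allFin n)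
countB-tabulate-suc {n} q =
  trans (cong (countB q) (≡-sym (map-tabulate id Fin.suc))) (countB-map q Fin.suc (allFin n))

countB-allFin-suc : ∀ (q : Fin (suc n) → Bool) →
  countB q (allFin (suc n)) ≡
  (if q Fin.zero then suc (countB (q ∘ Fin.suc) (allFin n)) else countB (q ∘ Fin.suc) (allFin n))
countB-allFin-suc q rewrite countB-tabulate-suc q = refl

countB-point : ∀ (q q′ : Fin n → Bool) (x : Fin n) → q x ≡ true → q′ x ≡ false →
               (∀ a → a ≢ x → q a ≡ q′ a) →
               countB q (allFin n) ≡ suc (countB q′ (allFin n))
countB-point {suc n} q q′ Fin.zero qx q′x q≡q′
  rewrite countB-allFin-suc q | countB-allFin-suc q′ | qx | q′x =
  cong suc (countB-ext (q ∘ Fin.suc) (q′ ∘ Fin.suc) (λ a → q≡q′ (Fin.suc a) λ ()) (allFin n))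
countB-point {suc n} q q′ (Fin.suc w) qx q′x q≡q′
  rewrite countB-allFin-suc q | countB-allFin-suc q′ | q≡q′ Fin.zero (λ ())
        | countB-point (q ∘ Fin.suc) (q′ ∘ Fin.suc) w qx q′x
                       (λ a a≢w → q≡q′ (Fin.suc a) (a≢w ∘ suc-injective))
  with q′ Fin.zero
... | true  = refl
... | false = refl

count : (Vec Bool n → Bool) → ℕ
count {n} P = countB P (allVecs n)

count-split : ∀ (P : Vec Bool (suc n) → Bool) →
              count P ≡ count (P ∘ (true ∷_)) + count (P ∘ (false ∷_))
count-split {n} P = trans (countB-++ P (map (true ∷_) (allVecs n)) (map (false ∷_) (allVecs n)))
  (cong₂ _+_ (countB-map P (true ∷_) (allVecs n)) (countB-map P (false ∷_) (allVecs n)))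

count-head-≤ : ∀ (P : Vec Bool (suc n) → Bool) c → count (P ∘ (c ∷_)) ≤ count P
count-head-≤ P true  = ≤-trans (m≤m+n _ _) (≤-reflexive (≡-sym (count-split P)))
count-head-≤ P false = ≤-trans (m≤n+m _ _) (≤-reflexive (≡-sym (count-split P)))

override : PAssign n → Vec Bool n → Vec Bool n
override D []      = []
override D (b ∷ τ) = fromMaybe b (D Fin.zero) ∷ override (D ∘ Fin.suc) τ

lookup-override : ∀ (D : PAssign n) σ a → lookup (override D σ) a ≡ fromMaybe (lookup σ a) (D a)
lookup-override D (b ∷ τ) Fin.zero    = refl
lookup-override D (b ∷ τ) (Fin.suc a) = lookup-override (D ∘ Fin.suc) τ a

#assigned : PAssign n → ℕ
#assigned {n} D = countB (is-just ∘ D) (allFin n)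

-- the head step of override-bound: summing the two halves of the count
-- costs a factor 2 exactly when the head variable is overridden
head-bound : ∀ (m : Maybe Bool) k (Q : Vec Bool (suc n) → Bool) →
  2 ^ k * count (Q ∘ (fromMaybe true m ∷_)) + 2 ^ k * count (Q ∘ (fromMaybe false m ∷_))
  ≤ 2 ^ (if is-just m then suc k else k) * count Q
head-bound nothing  k Q = ≤-reflexive (trans (≡-sym (*-distribˡ-+ (2 ^ k) _ _))
                                             (cong (2 ^ k *_) (≡-sym (count-split Q))))
head-bound (just c) k Q = begin
  2 ^ k * count Q_c + 2 ^ k * count Q_c  ≡⟨ cong (2 ^ k * count Q_c +_) (≡-sym (+-identityʳ _)) ⟩
  2 * (2 ^ k * count Q_c)                ≡⟨ ≡-sym (*-assoc 2 (2 ^ k) _) ⟩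
  2 ^ suc k * count Q_c                  ≤⟨ *-monoʳ-≤ (2 ^ suc k) (count-head-≤ Q c) ⟩
  2 ^ suc k * count Q                    ∎
  where
  open ≤-Reasoning
  Q_c = Q ∘ (c ∷_)

-- overriding k variables is at most 2^k-to-one
override-bound : ∀ (D : PAssign n) (P Q : Vec Bool n → Bool) →
  (∀ σ → P σ ≡ true → Q (override D σ) ≡ true) →
  count P ≤ 2 ^ #assigned D * count Q
override-bound {zero} D P Q P⇒Q =
  ≤-trans (countB-mono P Q (λ { [] → P⇒Q [] }) (allVecs 0)) (≤-reflexive (≡-sym (*-identityˡ _)))
override-bound {suc n} D P Q P⇒Q = begin
  count P                                    ≡⟨ count-split P ⟩
  count (P ∘ (true ∷_)) + count (P ∘ (false ∷_))
    ≤⟨ +-mono-≤ (halves true) (halves false) ⟩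
  2 ^ k * count (Q ∘ (fromMaybe true (D Fin.zero) ∷_))
    + 2 ^ k * count (Q ∘ (fromMaybe false (D Fin.zero) ∷_))
    ≤⟨ head-bound (D Fin.zero) k Q ⟩
  2 ^ (if is-just (D Fin.zero) then suc k else k) * count Q
    ≡⟨ cong (λ e → 2 ^ e * count Q) (≡-sym (countB-allFin-suc (is-just ∘ D))) ⟩
  2 ^ #assigned D * count Q                  ∎
  where
  open ≤-Reasoning
  k = #assigned (D ∘ Fin.suc)
  halves : ∀ b → count (P ∘ (b ∷_)) ≤ 2 ^ k * count (Q ∘ (fromMaybe b (D Fin.zero) ∷_))
  halves b = override-bound (D ∘ Fin.suc) (P ∘ (b ∷_)) _ (λ τ → P⇒Q (b ∷ τ))

Sat : Graph n → Vec Bool n → Set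
Sat G σ = ∀ a b → E G a b ≡ true → lookup σ a ∨ lookup σ b ≡ true

Extends : PAssign n → Vec Bool n → Set
Extends A σ = ∀ a → agreeLit (A a) (lookup σ a) ≡ true

Model : Graph n → PAssign n → Vec Bool n → Bool
Model G A σ = satφ G σ ∧ extends A σ

model-sound : ∀ (G : Graph n) A σ → Model G A σ ≡ true → Sat G σ × Extends A σ
model-sound G A σ m with ∧-elim (satφ G σ) (extends A σ) m
... | s , ext = sat , all-allFin-elim _ ext
  where
  sat : Sat G σ
  sat a b ab with all-allFin-elim _ (all-allFin-elim _ s a) b
  ... | clause rewrite ab = clause

model-complete : ∀ (G : Graph n) A σ → Sat G σ → Extends A σ → Model G A σ ≡ true
model-complete G A σ sat ext =
  ∧-intro (satφ G σ) (extends A σ)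
          (all-allFin-intro _ λ a → all-allFin-intro _ (clause a)) (all-allFin-intro _ ext)
  where
  clause : ∀ a b → not (E G a b) ∨ (lookup σ a ∨ lookup σ b) ≡ true
  clause a b with E G a b in ab
  ... | true  = sat a b ab
  ... | false = refl

agree-just : ∀ {b c} → agreeLit (just b) c ≡ true → c ≡ b
agree-just {true}            c≡true = c≡true
agree-just {false} {false}   _      = refl

extends-at : ∀ {A : PAssign n} σ a {b} → Extends A σ → A a ≡ just b → lookup σ a ≡ b
extends-at σ a ext Aa = agree-just (subst (λ m → agreeLit m (lookup σ a) ≡ true) Aa (ext a))

≔-same : ∀ (A : PAssign n) x b → (A [ x ≔ b ]) x ≡ just b
≔-same A x b with x ≟ x
... | yes _   = refl
... | no x≢x  = ⊥-elim (x≢x refl)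

≔-other : ∀ (A : PAssign n) {x a} b → a ≢ x → (A [ x ≔ b ]) a ≡ A a
≔-other A {x} {a} b a≢x with a ≟ x
... | yes a≡x = ⊥-elim (a≢x a≡x)
... | no _    = refl

forced-witness : ∀ (G : Graph n) A y → forcedB G A y ≡ true → Forced G A y
forced-witness {n} G A y f with satisfied (any⁻ _ (allFin n) (≡⇒T f))
... | z , yz×z0 with ∧-elim (E G y z) (isFalse (A z)) (T⇒≡ yz×z0)
...   | yz , z0 = z , yz , isFalse⇒ (A z) z0
  where
  isFalse⇒ : ∀ m → isFalse m ≡ true → m ≡ just false
  isFalse⇒ (just false) _ = refl

neighbour-≢ : ∀ (G : Graph n) {x w} → E G x w ≡ true → w ≢ x
neighbour-≢ G {x} xw refl with trans (≡-sym xw) (irrefl G x)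
... | ()

sat-relax : ∀ {G : Graph n} {σ} ρ x → Sat G σ →
  (∀ a → a ≢ x → lookup σ a ≡ true → lookup ρ a ≡ true) →
  (∀ w → E G x w ≡ true → lookup ρ x ∨ lookup ρ w ≡ true) →
  Sat G ρ
sat-relax {G = G} {σ} ρ x sat dom atx a b ab with a ≟ x | b ≟ x
... | yes refl | _        = atx b ab
... | no _     | yes refl =
  trans (∨-comm (lookup ρ a) (lookup ρ b)) (atx a (trans (Graph.sym G x a) ab))
... | no a≢x   | no b≢x   =
  ∨-intro (lookup ρ a) (lookup ρ b)
    (⊎-map (dom a a≢x) (dom b b≢x) (∨-elim (lookup σ a) (lookup σ b) (sat a b ab)))

raiseIf : Bool → Maybe Bool
raiseIf b = if b then just true else nothing

is-just-raiseIf : ∀ b → is-just (raiseIf b) ≡ b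
is-just-raiseIf true  = refl
is-just-raiseIf false = refl

fromMaybe-raiseIf : ∀ v b → fromMaybe v (raiseIf b) ≡ b ∨ v
fromMaybe-raiseIf v true  = refl
fromMaybe-raiseIf v false = refl

trueOn : (Fin n → Bool) → PAssign n
trueOn q a = raiseIf (q a)

push : Fin n → Bool → (Fin n → Bool) → Vec Bool n → Vec Bool n
push x c q = override (trueOn q [ x ≔ c ])

push-at : ∀ x c (q : Fin n → Bool) σ → lookup (push x c q σ) x ≡ c
push-at x c q σ = trans (lookup-override _ σ x) (cong (fromMaybe _) (≔-same (trueOn q) x c))

push-off : ∀ {x a} c (q : Fin n → Bool) σ → a ≢ x → lookup (push x c q σ) a ≡ q a ∨ lookup σ a
push-off {a = a} c q σ a≢x =
  trans (lookup-override _ σ a)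
        (trans (cong (fromMaybe _) (≔-other (trueOn q) c a≢x)) (fromMaybe-raiseIf (lookup σ a) (q a)))

#assigned-push : ∀ x c (q : Fin n → Bool) → q x ≡ false →
                 #assigned (trueOn q [ x ≔ c ]) ≡ suc (countB q (allFin n))
#assigned-push {n} x c q qx =
  trans (countB-point _ _ x (cong is-just (≔-same (trueOn q) x c)) (cong (is-just ∘ raiseIf) qx)
                      (λ a a≢x → cong is-just (≔-other (trueOn q) c a≢x)))
        (cong suc (countB-ext _ q (is-just-raiseIf ∘ q) (allFin n)))

agree-refl : ∀ b → agreeLit (just b) b ≡ true
agree-refl true  = refl
agree-refl false = refl

agree-raise : ∀ {m : Maybe Bool} r v → (r ≡ true → m ≡ nothing) →
              agreeLit m v ≡ true → agreeLit m (r ∨ v) ≡ true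
agree-raise true  v unassigned _ rewrite unassigned refl = refl
agree-raise false v _          m~v = m~v

extends-push : ∀ {B : PAssign n} x c q σ → (∀ a → q a ≡ true → B a ≡ nothing) →
               Extends B σ → Extends (B [ x ≔ c ]) (push x c q σ)
extends-push {B = B} x c q σ free ext a with a ≟ x
... | yes refl = subst (λ v → agreeLit (just c) v ≡ true) (≡-sym (push-at x c q σ)) (agree-refl c)
... | no a≢x   = subst (λ v → agreeLit (B a) v ≡ true) (≡-sym (push-off c q σ a≢x))
                       (agree-raise (q a) (lookup σ a) (free a) (ext a))

restriction-bound : ∀ (G : Graph n) B x c q → q x ≡ false →
  (∀ a → q a ≡ true → B a ≡ nothing) →
  (∀ σ → Sat G σ → Extends B σ → Sat G (push x c q σ)) →
  #φ G B ≤ 2 ^ suc (countB q (allFin n)) * #φ G (B [ x ≔ c ])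
restriction-bound G B x c q qx free preserves =
  subst (λ k → #φ G B ≤ 2 ^ k * #φ G (B [ x ≔ c ])) (#assigned-push x c q qx)
        (override-bound (trueOn q [ x ≔ c ]) (Model G B) (Model G (B [ x ≔ c ])) maps)
  where
  maps : ∀ σ → Model G B σ ≡ true → Model G (B [ x ≔ c ]) (push x c q σ) ≡ true
  maps σ m with model-sound G B σ m
  ... | sat , ext = model-complete G (B [ x ≔ c ]) (push x c q σ)
                                   (preserves σ sat ext) (extends-push x c q σ free ext)

-- |F|_x| ≥ |F| / 2 : raising x keeps every clause satisfied
count-true-bound : ∀ (G : Graph n) B x → #φ G B ≤ 2 * #φ G (B [ x ≔ true ])
count-true-bound {n} G B x =
  subst (λ k → #φ G B ≤ 2 ^ suc k * #φ G (B [ x ≔ true ])) (countB-false (allFin n))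
        (restriction-bound G B x true nobody refl (λ _ ()) raising)
  where
  nobody : Fin n → Bool
  nobody _ = false
  raising : ∀ σ → Sat G σ → Extends B σ → Sat G (push x true nobody σ)
  raising σ sat _ = sat-relax {G = G} {σ} (push x true nobody σ) x sat
                              (λ a a≢x σa → trans (push-off true nobody σ a≢x) σa)
                              (λ w _ → cong (_∨ lookup ρ w) (push-at x true nobody σ))
    where
    ρ = push x true nobody σ

freeNeighbour : Graph n → PAssign n → Fin n → Fin n → Bool
freeNeighbour G B x y = E G x y ∧ (isNothing (B y) ∧ not (forcedB G B y))

neighbour-covered : ∀ {G : Graph n} {B x} σ w → ¬ Forced G B x → Sat G σ → Extends B σ →
  E G x w ≡ true → freeNeighbour G B x w ≡ true ⊎ lookup σ w ≡ true
neighbour-covered {G = G} {B} {x} σ w unforced sat ext xw with B w in Bw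
... | just true  = inj₂ (extends-at {A = B} σ w ext Bw)
... | just false = ⊥-elim (unforced (w , xw , Bw))
... | nothing with forcedB G B w in fw
...   | false = inj₁ (cong (_∧ true) xw)  -- the goal has reduced to E G x w ∧ true ≡ true
...   | true with forced-witness G B w fw
...     | z , wz , Bz =
  inj₂ (∨-resolveʳ (lookup σ w) (lookup σ z) (sat w z wz) (extends-at {A = B} σ z ext Bz))

-- |F|_¬x| ≥ |F| / 2^(|N(x)|+1) : lowering x is repaired by raising N(x)
count-false-bound : ∀ (G : Graph n) {B x} → ¬ Forced G B x →
  #φ G B ≤ 2 ^ suc (#N G B x) * #φ G (B [ x ≔ false ])
count-false-bound G {B} {x} unforced =
  restriction-bound G B x false N xx free repairing
  where
  N = freeNeighbour G B x
  xx : N x ≡ false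
  xx rewrite irrefl G x = refl
  free : ∀ a → N a ≡ true → B a ≡ nothing
  free a Na = unassigned (B a)
                (proj₁ (∧-elim _ (not (forcedB G B a)) (proj₂ (∧-elim (E G x a) _ Na))))
    where
    unassigned : ∀ m → isNothing m ≡ true → m ≡ nothing
    unassigned nothing _ = refl
  repairing : ∀ σ → Sat G σ → Extends B σ → Sat G (push x false N σ)
  repairing σ sat ext = sat-relax {G = G} {σ} (push x false N σ) x sat
    (λ a a≢x σa → trans (push-off false N σ a≢x) (∨-intro (N a) (lookup σ a) (inj₂ σa)))
    (λ w xw → trans (cong (_∨ lookup ρ w) (push-at x false N σ))
                    (trans (push-off false N σ (neighbour-≢ G xw))
                           (∨-intro (N w) (lookup σ w) (covered w xw))))
    where
    ρ = push x false N σ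
    covered : ∀ w → E G x w ≡ true → N w ≡ true ⊎ lookup σ w ≡ true
    covered w = neighbour-covered {G = G} {B} {x} σ w unforced sat ext

lemma10 : ∀ {n : ℕ} (G : Graph n) → NoIsolated G → (T : SCDT G) →
          ∀ {B : PAssign n} {x} → NodeAt T B x → ¬ Forced G B x →
          (#φ G B ≤ 2 ^ suc (#N G B x) * #φ G (B [ x ≔ false ]))
          × (#φ G B ≤ 2 * #φ G (B [ x ≔ true ]))
lemma10 G _ _ {B} {x} _ unforced = count-false-bound G unforced , count-true-bound G B x
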